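{- For all $n\ge 0$, $$S(2n+1)=3S(n)-S(2n),\qquad S(4n)=2S(2n)-S(n),\qquad S(4n+2)=4S(n)-S(2n).$$ In particular, $(S(n))_{n\ge 0}$ is $2$-regular.
   Context: For finite words $u,v$ over $\{0,1\}$, $\binom{u}{v}$ denotes the number of occurrences of $v$ as a (scattered) subword (subsequence) of $u$. For $n\ge 1$, $\mathrm{rep}_2(n)$ is the base-$2$ expansion of $n$ with most significant digit first, and $\mathrm{rep}_2(0)=\varepsilon$. Let $L_2=\{\varepsilon\}\cup 1\{0,1\}^*$ and $S(n)=\#\{v\in L_2 : \binom{\mathrm{rep}_2(n)}{v}>0\}$. For an integer $k\ge 2$, the $k$-kernel of a sequence $s=(s(n))_{n\ge 0}$ is the set of sequences $\{(s(k^i n+j))_{n\ge 0} : i\ge 0,\ 0\le j<k^i\}$; the sequence $s$ is $k$-regular if the $\mathbb{Z}$-module generated by its $k$-kernel is finitely generated. -}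

module Defs where

open import Data.Bool using (Bool; true; false; if_then_else_; _∧_)
open import Data.Nat using (ℕ; zero; suc; _+_; _*_; _^_; _<_; _/_; _%_; _≡ᵇ_; _<ᵇ_)
open import Data.Integer using (ℤ; 0ℤ) renaming (_+_ to _+ℤ_; _*_ to _*ℤ_)
open import Data.List using (List; []; _∷_; _++_; [_]; length; filterᵇ; map; concatMap)
open import Data.List.Relation.Unary.All using (All)
open import Data.List.Membership.Propositional using (_∈_)
open import Data.Product using (Σ; _×_; _,_; ∃; ∃-syntax; proj₂)
open import Relation.Binary.PropositionalEquality using (_≡_)

-- Binary words: false = letter 0, true = letter 1.
Word : Set
Word = List Bool

_==_ : Bool → Bool → Bool
true  == true  = true
false == false = true
_     == _     = false

binom : Word → Word → ℕ
binom u       []      = 1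
binom []      (_ ∷ _) = 0
binom (a ∷ u) (b ∷ v) = binom u (b ∷ v) + (if a == b then binom u v else 0)

-- rep₂ n : base-2 expansion, most significant digit first; rep₂ 0 = ε.
-- (fuel-driven recursion; fuel n suffices since n has at most n binary digits)
rep₂-go : ℕ → ℕ → Word
rep₂-go zero    _       = []
rep₂-go (suc f) zero    = []
rep₂-go (suc f) (suc m) = rep₂-go f (suc m / 2) ++ [ suc m % 2 ≡ᵇ 1 ]

rep₂ : ℕ → Word
rep₂ n = rep₂-go n n

inL₂ : Word → Bool
inL₂ []          = true
inL₂ (true ∷ _)  = true
inL₂ (false ∷ _) = false

wordsOfLength : ℕ → List Word
wordsOfLength zero    = [] ∷ []
wordsOfLength (suc m) = concatMap (λ w → (false ∷ w) ∷ (true ∷ w) ∷ []) (wordsOfLength m)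

wordsUpTo : ℕ → List Word
wordsUpTo zero    = wordsOfLength zero
wordsUpTo (suc m) = wordsUpTo m ++ wordsOfLength (suc m)

-- S n = #{ v ∈ L₂ : binom (rep₂ n) v > 0 }.  A word v with binom u v > 0 has
-- length ≤ |u|, so it suffices to enumerate words of length ≤ |rep₂ n|.
S : ℕ → ℕ
S n = length (filterᵇ (λ v → inL₂ v ∧ (0 <ᵇ binom (rep₂ n) v)) (wordsUpTo (length (rep₂ n))))

Seq : Set
Seq = ℕ → ℤ

InKernel : ℕ → Seq → Seq → Set
InKernel k s f = ∃[ i ] ∃[ j ] (j < k ^ i) × (∀ n → f n ≡ s (k ^ i * n + j))

evalComb : List (ℤ × Seq) → ℕ → ℤ
evalComb []             n = 0ℤ
evalComb ((c , g) ∷ cs) n = c *ℤ g n +ℤ evalComb cs n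

InSpan : (Seq → Set) → Seq → Set
InSpan P f = Σ (List (ℤ × Seq)) λ cs → All (λ p → P (proj₂ p)) cs × (∀ n → f n ≡ evalComb cs n)

IsRegular : ℕ → Seq → Set
IsRegular k s =
  Σ (List Seq) λ gs →
    All (InSpan (InKernel k s)) gs ×
    (∀ f → InKernel k s f → InSpan (λ g → g ∈ gs) f)

module Submission where

-- Let σ b x be the number of distinct subwords of x that are empty or begin with b, so that
-- S n = σ 1 (rep₂ n).  Splitting off the first letter gives σ b (a x) = σ 0 x + σ 1 x when a = b,
-- and σ b (a x) = σ b x otherwise.  Hence a relation σ b x + σ b y = k σ b z holding for both
-- letters b persists when a common prefix is prepended to x, y and z.  With prefix rep₂ n, the
-- three recurrences come from (x, y, z) = (1, 0, ε), (00, ε, 0) and (10, 0, ε), where they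
-- are finite computations.
-- The recurrences make the sequences a S(n) + b S(2n) closed under n ↦ 2n and n ↦ 2n + 1, so
-- the whole 2-kernel lies in the module generated by S(n) and S(2n).

open import Defs
open import Data.Bool using (Bool; true; false; if_then_else_; _∧_)
open import Data.Bool.Properties using (∧-zeroʳ)
open import Data.Nat using (ℕ; zero; suc; _+_; _*_; _^_; _<_; _≤_; _/_; _%_; _≡ᵇ_; _<ᵇ_; z≤n; s≤s; s≤s⁻¹; NonZero)
open import Data.Nat.Properties using (+-assoc; m+n≡0⇒m≡0; +-identityʳ; +-comm; *-comm; *-distribˡ-+; ≤-refl; ≤-trans; n≤1+n; +-commutativeSemigroup)
open import Algebra.Properties.CommutativeSemigroup +-commutativeSemigroup using (interchange)
open import Data.Nat.DivMod using (m/n<m; m≡m%n+[m/n]*n; m%n<n; m<n*o⇒m/o<n; +-distrib-/-∣ʳ; m*n/n≡m; m<n⇒m/n≡0; m<n⇒m%n≡m; [m+kn]%n≡m%n)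
open import Data.Nat.Divisibility using (n∣m*n)
open import Data.Integer using (ℤ; +_; _-_; 0ℤ; 1ℤ; -1ℤ) renaming (_+_ to _+ℤ_; _*_ to _*ℤ_)
open import Data.Integer.Properties using (pos-+; pos-*) renaming (+-identityʳ to +ℤ-identityʳ)
open import Data.List using (List; []; _∷_; _++_; [_]; length; filterᵇ; null; concatMap)
open import Data.List.Properties using (++-assoc; ++-identityʳ)
open import Data.List.Relation.Unary.All using ([]; _∷_)
open import Data.List.Relation.Unary.Any using (here; there)
open import Data.List.Membership.Propositional using (_∈_)
open import Data.Product using (Σ; _×_; _,_)
open import Function using (_∘_)
open import Relation.Binary.PropositionalEquality using (_≡_; refl; sym; trans; cong; cong₂; subst; module ≡-Reasoning)
import Data.Nat.Tactic.RingSolver as ℕ-Solver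
import Data.Integer.Tactic.RingSolver as ℤ-Solver

bit : Bool → ℕ
bit true  = 1
bit false = 0

count : {A : Set} → (A → Bool) → List A → ℕ
count p []       = 0
count p (x ∷ xs) = bit (p x) + count p xs

module _ {A : Set} where

  length-filterᵇ : ∀ (p : A → Bool) xs → length (filterᵇ p xs) ≡ count p xs
  length-filterᵇ p []       = refl
  length-filterᵇ p (x ∷ xs) with p x
  ... | true  = cong suc (length-filterᵇ p xs)
  ... | false = length-filterᵇ p xs

  count-++ : ∀ (p : A → Bool) xs ys → count p (xs ++ ys) ≡ count p xs + count p ys
  count-++ p []       ys = refl
  count-++ p (x ∷ xs) ys = trans (cong (_+_ (bit (p x))) (count-++ p xs ys)) (sym (+-assoc (bit (p x)) _ _))

  count-cong : ∀ {p q : A → Bool} → (∀ x → p x ≡ q x) → ∀ xs → count p xs ≡ count q xs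
  count-cong p≡q []       = refl
  count-cong p≡q (x ∷ xs) = cong₂ _+_ (cong bit (p≡q x)) (count-cong p≡q xs)

  count-false : ∀ xs → count {A} (λ _ → false) xs ≡ 0
  count-false []       = refl
  count-false (x ∷ xs) = count-false xs

  count-+ : ∀ {p q r s : A → Bool} → (∀ x → bit (p x) + bit (q x) ≡ bit (r x) + bit (s x)) →
            ∀ xs → count p xs + count q xs ≡ count r xs + count s xs
  count-+ pointwise []       = refl
  count-+ {p} {q} {r} {s} pointwise (x ∷ xs) = begin
    (bit (p x) + count p xs) + (bit (q x) + count q xs) ≡⟨ interchange (bit (p x)) _ _ _ ⟩
    (bit (p x) + bit (q x)) + (count p xs + count q xs) ≡⟨ cong₂ _+_ (pointwise x) (count-+ pointwise xs) ⟩
    (bit (r x) + bit (s x)) + (count r xs + count s xs) ≡⟨ sym (interchange (bit (r x)) _ _ _) ⟩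
    (bit (r x) + count r xs) + (bit (s x) + count s xs) ∎
    where open ≡-Reasoning

count-wordsOfLength-suc : ∀ (p : Word → Bool) k →
  count p (wordsOfLength (suc k))
    ≡ count (p ∘ (false ∷_)) (wordsOfLength k) + count (p ∘ (true ∷_)) (wordsOfLength k)
count-wordsOfLength-suc p k = go (wordsOfLength k)
  where
  both : Word → List Word
  both w = (false ∷ w) ∷ (true ∷ w) ∷ []
  go : ∀ ws → count p (concatMap both ws) ≡ count (p ∘ (false ∷_)) ws + count (p ∘ (true ∷_)) ws
  go []       = refl
  go (w ∷ ws) = begin
    bit (p (false ∷ w)) + (bit (p (true ∷ w)) + count p (concatMap both ws))
      ≡⟨ cong (λ c → bit (p (false ∷ w)) + (bit (p (true ∷ w)) + c)) (go ws) ⟩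
    bit (p (false ∷ w)) + (bit (p (true ∷ w)) + (count (p ∘ (false ∷_)) ws + count (p ∘ (true ∷_)) ws))
      ≡⟨ sym (+-assoc (bit (p (false ∷ w))) _ _) ⟩
    (bit (p (false ∷ w)) + bit (p (true ∷ w))) + (count (p ∘ (false ∷_)) ws + count (p ∘ (true ∷_)) ws)
      ≡⟨ interchange (bit (p (false ∷ w))) _ _ _ ⟩
    count (p ∘ (false ∷_)) (w ∷ ws) + count (p ∘ (true ∷_)) (w ∷ ws) ∎
    where open ≡-Reasoning

count-wordsUpTo-suc : ∀ (p : Word → Bool) m →
  count p (wordsUpTo (suc m))
    ≡ bit (p []) + (count (p ∘ (false ∷_)) (wordsUpTo m) + count (p ∘ (true ∷_)) (wordsUpTo m))
count-wordsUpTo-suc p zero    = cong (_+_ (bit (p []))) (count-wordsOfLength-suc p zero)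
count-wordsUpTo-suc p (suc m) = begin
  count p (wordsUpTo (suc m) ++ wordsOfLength (suc (suc m)))
    ≡⟨ count-++ p (wordsUpTo (suc m)) _ ⟩
  count p (wordsUpTo (suc m)) + count p (wordsOfLength (suc (suc m)))
    ≡⟨ cong₂ _+_ (count-wordsUpTo-suc p m) (count-wordsOfLength-suc p (suc m)) ⟩
  (bit (p []) + (count p₀ (wordsUpTo m) + count p₁ (wordsUpTo m)))
    + (count p₀ (wordsOfLength (suc m)) + count p₁ (wordsOfLength (suc m)))
    ≡⟨ +-assoc (bit (p [])) _ _ ⟩
  bit (p []) + ((count p₀ (wordsUpTo m) + count p₁ (wordsUpTo m))
    + (count p₀ (wordsOfLength (suc m)) + count p₁ (wordsOfLength (suc m))))
    ≡⟨ cong (_+_ (bit (p []))) (interchange (count p₀ (wordsUpTo m)) _ _ _) ⟩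
  bit (p []) + ((count p₀ (wordsUpTo m) + count p₀ (wordsOfLength (suc m)))
    + (count p₁ (wordsUpTo m) + count p₁ (wordsOfLength (suc m))))
    ≡⟨ cong (_+_ (bit (p []))) (sym (cong₂ _+_ (count-++ p₀ (wordsUpTo m) _) (count-++ p₁ (wordsUpTo m) _))) ⟩
  bit (p []) + (count p₀ (wordsUpTo (suc m)) + count p₁ (wordsUpTo (suc m))) ∎
  where
  open ≡-Reasoning
  p₀ p₁ : Word → Bool
  p₀ = p ∘ (false ∷_)
  p₁ = p ∘ (true ∷_)

count-null-wordsUpTo : ∀ m → count null (wordsUpTo m) ≡ 1
count-null-wordsUpTo zero    = refl
count-null-wordsUpTo (suc m) = trans (count-wordsUpTo-suc null m)
  (cong suc (cong₂ _+_ (count-false (wordsUpTo m)) (count-false (wordsUpTo m))))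

occurs : Word → Word → Bool
occurs u v = 0 <ᵇ binom u v

binom-∷-≡0 : ∀ u w c → binom u w ≡ 0 → binom u (c ∷ w) ≡ 0
binom-∷-≡0 []      w       c _ = refl
binom-∷-≡0 (a ∷ u) (d ∷ w) c h = cong₂ _+_ (binom-∷-≡0 u (d ∷ w) c tail≡0) (if-0 (a == c))
  where
  tail≡0 : binom u (d ∷ w) ≡ 0
  tail≡0 = m+n≡0⇒m≡0 (binom u (d ∷ w)) h
  if-0 : ∀ e → (if e then binom u (d ∷ w) else 0) ≡ 0
  if-0 true  = tail≡0
  if-0 false = refl

occurs-∷ : ∀ a u c w → occurs (a ∷ u) (c ∷ w) ≡ (if a == c then occurs u w else occurs u (c ∷ w))
occurs-∷ a u c w with a == c
... | false = cong (0 <ᵇ_) (+-identityʳ (binom u (c ∷ w)))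
... | true with binom u w in eq
...   | zero  = cong (0 <ᵇ_) (trans (+-identityʳ _) (binom-∷-≡0 u w c eq))
...   | suc k = cong (0 <ᵇ_) (+-comm (binom u (c ∷ w)) (suc k))

σ : Bool → Word → ℕ
σ b []      = 1
σ b (a ∷ x) = if a == b then σ false x + σ true x else σ b x

emptyOr : Bool → Word → Bool
emptyOr b []      = true
emptyOr b (a ∷ _) = a == b

emptyOr-occurs-skip : ∀ b a → a == b ≡ false → ∀ x v →
  emptyOr b v ∧ occurs (a ∷ x) v ≡ emptyOr b v ∧ occurs x v
emptyOr-occurs-skip b     a     _  x []          = refl
emptyOr-occurs-skip false true  _  x (false ∷ w) = occurs-∷ true x false w
emptyOr-occurs-skip false true  _  x (true ∷ w)  = refl
emptyOr-occurs-skip true  false _  x (true ∷ w)  = occurs-∷ false x true w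
emptyOr-occurs-skip true  false _  x (false ∷ w) = refl

emptyOr-occurs-head : ∀ b x w →
  bit (emptyOr b (false ∷ w) ∧ occurs (b ∷ x) (false ∷ w)) + bit (emptyOr b (true ∷ w) ∧ occurs (b ∷ x) (true ∷ w))
  ≡ bit (occurs x w) + bit false
emptyOr-occurs-head false x w = cong (λ o → bit o + 0) (occurs-∷ false x false w)
emptyOr-occurs-head true  x w = trans (cong bit (occurs-∷ true x true w)) (sym (+-identityʳ _))

occurs-split : ∀ x v →
  bit (occurs x v) + bit (null v) ≡ bit (emptyOr false v ∧ occurs x v) + bit (emptyOr true v ∧ occurs x v)
occurs-split x []          = refl
occurs-split x (false ∷ w) = refl
occurs-split x (true ∷ w)  = +-comm (bit (occurs x (true ∷ w))) 0

mutual
  count-occurs : ∀ b x m → length x ≤ m → count (λ v → emptyOr b v ∧ occurs x v) (wordsUpTo m) ≡ σ b x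
  count-occurs b     []          m       _         = trans (count-cong empty (wordsUpTo m)) (count-null-wordsUpTo m)
    where
    empty : ∀ v → emptyOr b v ∧ occurs [] v ≡ null v
    empty []      = refl
    empty (_ ∷ _) = ∧-zeroʳ _
  count-occurs false (false ∷ x) (suc m) (s≤s x≤m) = count-occurs-head false x m x≤m
  count-occurs true  (true ∷ x)  (suc m) (s≤s x≤m) = count-occurs-head true x m x≤m
  count-occurs false (true ∷ x)  m       x<m       = count-occurs-skip false true refl x m x<m
  count-occurs true  (false ∷ x) m       x<m       = count-occurs-skip true false refl x m x<m

  count-occurs-skip : ∀ b a → a == b ≡ false → ∀ x m → suc (length x) ≤ m →
    count (λ v → emptyOr b v ∧ occurs (a ∷ x) v) (wordsUpTo m) ≡ σ b x
  count-occurs-skip b a a≢b x m x<m =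
    trans (count-cong (emptyOr-occurs-skip b a a≢b x) (wordsUpTo m)) (count-occurs b x m (≤-trans (n≤1+n _) x<m))

  count-occurs-head : ∀ b x m → length x ≤ m →
    count (λ v → emptyOr b v ∧ occurs (b ∷ x) v) (wordsUpTo (suc m)) ≡ σ false x + σ true x
  count-occurs-head b x m x≤m = begin
    count p (wordsUpTo (suc m))
      ≡⟨ count-wordsUpTo-suc p m ⟩
    suc (count (p ∘ (false ∷_)) (wordsUpTo m) + count (p ∘ (true ∷_)) (wordsUpTo m))
      ≡⟨ cong suc (count-+ (emptyOr-occurs-head b x) (wordsUpTo m)) ⟩
    suc (count (occurs x) (wordsUpTo m) + count (λ _ → false) (wordsUpTo m))
      ≡⟨ cong (λ k → suc (count (occurs x) (wordsUpTo m) + k)) (count-false (wordsUpTo m)) ⟩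
    suc (count (occurs x) (wordsUpTo m) + 0)
      ≡⟨ trans (cong suc (+-identityʳ _)) (+-comm 1 _) ⟩
    count (occurs x) (wordsUpTo m) + 1
      ≡⟨ cong (_+_ (count (occurs x) (wordsUpTo m))) (sym (count-null-wordsUpTo m)) ⟩
    count (occurs x) (wordsUpTo m) + count null (wordsUpTo m)
      ≡⟨ count-+ (occurs-split x) (wordsUpTo m) ⟩
    count (λ v → emptyOr false v ∧ occurs x v) (wordsUpTo m) + count (λ v → emptyOr true v ∧ occurs x v) (wordsUpTo m)
      ≡⟨ cong₂ _+_ (count-occurs false x m x≤m) (count-occurs true x m x≤m) ⟩
    σ false x + σ true x ∎
    where
    open ≡-Reasoning
    p : Word → Bool
    p v = emptyOr b v ∧ occurs (b ∷ x) v

inL₂≗emptyOr-true : ∀ v → inL₂ v ≡ emptyOr true v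
inL₂≗emptyOr-true []          = refl
inL₂≗emptyOr-true (false ∷ _) = refl
inL₂≗emptyOr-true (true ∷ _)  = refl

S≡σ : ∀ n → S n ≡ σ true (rep₂ n)
S≡σ n = begin
  length (filterᵇ p (wordsUpTo (length u)))
    ≡⟨ length-filterᵇ p (wordsUpTo (length u)) ⟩
  count p (wordsUpTo (length u))
    ≡⟨ count-cong (λ v → cong (_∧ occurs u v) (inL₂≗emptyOr-true v)) (wordsUpTo (length u)) ⟩
  count (λ v → emptyOr true v ∧ occurs u v) (wordsUpTo (length u))
    ≡⟨ count-occurs true u (length u) ≤-refl ⟩
  σ true u ∎
  where
  open ≡-Reasoning
  u : Word
  u = rep₂ n
  p : Word → Bool
  p v = inL₂ v ∧ occurs u v

record Balanced (k : ℕ) (x y z : Word) : Set where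
  constructor balanced
  field σ-balanced : ∀ b → σ b x + σ b y ≡ k * σ b z
open Balanced

Balanced-total : ∀ {k x y z} → Balanced k x y z →
  (σ false x + σ true x) + (σ false y + σ true y) ≡ k * (σ false z + σ true z)
Balanced-total {k} {x} {y} {z} bal = begin
  (σ false x + σ true x) + (σ false y + σ true y) ≡⟨ interchange (σ false x) (σ true x) (σ false y) (σ true y) ⟩
  (σ false x + σ false y) + (σ true x + σ true y) ≡⟨ cong₂ _+_ (σ-balanced bal false) (σ-balanced bal true) ⟩
  k * σ false z + k * σ true z                    ≡⟨ sym (*-distribˡ-+ k (σ false z) (σ true z)) ⟩
  k * (σ false z + σ true z) ∎
  where open ≡-Reasoning

Balanced-∷ : ∀ {k x y z} a → Balanced k x y z → Balanced k (a ∷ x) (a ∷ y) (a ∷ z)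
Balanced-∷ {k} {x} {y} {z} a bal = balanced (prepend a)
  where
  prepend : ∀ a b → σ b (a ∷ x) + σ b (a ∷ y) ≡ k * σ b (a ∷ z)
  prepend false true  = σ-balanced bal true
  prepend true  false = σ-balanced bal false
  prepend false false = Balanced-total bal
  prepend true  true  = Balanced-total bal

Balanced-++ : ∀ {k x y z} u → Balanced k x y z → Balanced k (u ++ x) (u ++ y) (u ++ z)
Balanced-++ []      bal = bal
Balanced-++ (a ∷ u) bal = Balanced-∷ a (Balanced-++ u bal)

[1+m]/2≤m : ∀ m → suc m / 2 ≤ m
[1+m]/2≤m m = s≤s⁻¹ (m/n<m (suc m) 2 (s≤s (s≤s z≤n)))

rep₂-go-fuel : ∀ {f g} n → n ≤ f → n ≤ g → rep₂-go f n ≡ rep₂-go g n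
rep₂-go-fuel {zero}  {zero}  zero    _         _         = refl
rep₂-go-fuel {zero}  {suc g} zero    _         _         = refl
rep₂-go-fuel {suc f} {zero}  zero    _         _         = refl
rep₂-go-fuel {suc f} {suc g} zero    _         _         = refl
rep₂-go-fuel {suc f} {suc g} (suc m) (s≤s m≤f) (s≤s m≤g) =
  cong (_++ [ suc m % 2 ≡ᵇ 1 ]) (rep₂-go-fuel (suc m / 2) (≤-trans ([1+m]/2≤m m) m≤f) (≤-trans ([1+m]/2≤m m) m≤g))

rep₂-step : ∀ n .{{_ : NonZero n}} → rep₂ n ≡ rep₂ (n / 2) ++ [ n % 2 ≡ᵇ 1 ]
rep₂-step (suc m) = cong (_++ [ suc m % 2 ≡ᵇ 1 ]) (rep₂-go-fuel (suc m / 2) ([1+m]/2≤m m) ≤-refl)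

rep₂-digit : ∀ q r → r < 2 → .{{_ : NonZero (r + q * 2)}} → rep₂ (r + q * 2) ≡ rep₂ q ++ [ r ≡ᵇ 1 ]
rep₂-digit q r r<2 = trans (rep₂-step (r + q * 2)) (cong₂ (λ a d → rep₂ a ++ [ d ≡ᵇ 1 ]) quotient remainder)
  where
  quotient : (r + q * 2) / 2 ≡ q
  quotient = trans (+-distrib-/-∣ʳ r (n∣m*n q)) (cong₂ _+_ (m<n⇒m/n≡0 r<2) (m*n/n≡m q 2))
  remainder : (r + q * 2) % 2 ≡ r
  remainder = trans ([m+kn]%n≡m%n r q 2) (m<n⇒m%n≡m r<2)

rep₂-odd : ∀ q → rep₂ (1 + q * 2) ≡ rep₂ q ++ [ true ]
rep₂-odd q = rep₂-digit q 1 (s≤s (s≤s z≤n))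

rep₂-even : ∀ p → rep₂ (suc p * 2) ≡ rep₂ (suc p) ++ [ false ]
rep₂-even p = rep₂-digit (suc p) 0 (s≤s z≤n)

rep₂-[2n+1] : ∀ n → rep₂ (2 * n + 1) ≡ rep₂ n ++ [ true ]
rep₂-[2n+1] n = trans (cong rep₂ (arith n)) (rep₂-odd n)
  where
  arith : ∀ n → 2 * n + 1 ≡ 1 + n * 2
  arith = ℕ-Solver.solve-∀

-- These need n > 0, since rep₂ 0 is ε rather than 0.
rep₂-[2n] : ∀ m → rep₂ (2 * suc m) ≡ rep₂ (suc m) ++ [ false ]
rep₂-[2n] m = trans (cong rep₂ (*-comm 2 (suc m))) (rep₂-even m)

rep₂-[4n] : ∀ m → rep₂ (4 * suc m) ≡ rep₂ (suc m) ++ false ∷ false ∷ []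
rep₂-[4n] m = begin
  rep₂ (4 * suc m)                          ≡⟨ cong rep₂ (arith m) ⟩
  rep₂ (suc (suc (m * 2)) * 2)              ≡⟨ rep₂-even (suc (m * 2)) ⟩
  rep₂ (suc m * 2) ++ [ false ]             ≡⟨ cong (_++ [ false ]) (rep₂-even m) ⟩
  (rep₂ (suc m) ++ [ false ]) ++ [ false ]  ≡⟨ ++-assoc (rep₂ (suc m)) [ false ] [ false ] ⟩
  rep₂ (suc m) ++ false ∷ false ∷ [] ∎
  where
  open ≡-Reasoning
  arith : ∀ m → 4 * suc m ≡ suc (suc (m * 2)) * 2
  arith = ℕ-Solver.solve-∀

rep₂-[4n+2] : ∀ n → rep₂ (4 * n + 2) ≡ rep₂ n ++ true ∷ false ∷ []
rep₂-[4n+2] n = begin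
  rep₂ (4 * n + 2)                      ≡⟨ cong rep₂ (arith n) ⟩
  rep₂ (suc (n * 2) * 2)                ≡⟨ rep₂-even (n * 2) ⟩
  rep₂ (1 + n * 2) ++ [ false ]         ≡⟨ cong (_++ [ false ]) (rep₂-odd n) ⟩
  (rep₂ n ++ [ true ]) ++ [ false ]     ≡⟨ ++-assoc (rep₂ n) [ true ] [ false ] ⟩
  rep₂ n ++ true ∷ false ∷ [] ∎
  where
  open ≡-Reasoning
  arith : ∀ n → 4 * n + 2 ≡ suc (n * 2) * 2
  arith = ℕ-Solver.solve-∀

S-balanced : ∀ {k x y z} u p q r → rep₂ p ≡ u ++ x → rep₂ q ≡ u ++ y → rep₂ r ≡ u ++ z →
  Balanced k x y z → S p + S q ≡ k * S r
S-balanced {k} {x} {y} {z} u p q r p≡ux q≡uy r≡uz bal = begin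
  S p + S q                             ≡⟨ cong₂ _+_ (S≡σ p) (S≡σ q) ⟩
  σ true (rep₂ p) + σ true (rep₂ q)     ≡⟨ cong₂ (λ v w → σ true v + σ true w) p≡ux q≡uy ⟩
  σ true (u ++ x) + σ true (u ++ y)     ≡⟨ σ-balanced (Balanced-++ u bal) true ⟩
  k * σ true (u ++ z)                   ≡⟨ cong (λ w → k * σ true w) (sym r≡uz) ⟩
  k * σ true (rep₂ r)                   ≡⟨ cong (k *_) (sym (S≡σ r)) ⟩
  k * S r ∎
  where open ≡-Reasoning

Balanced-[2n+1] : Balanced 3 [ true ] [ false ] []
Balanced-[2n+1] = balanced λ { false → refl ; true → refl }

Balanced-[4n] : Balanced 2 (false ∷ false ∷ []) [] [ false ]
Balanced-[4n] = balanced λ { false → refl ; true → refl }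

Balanced-[4n+2] : Balanced 4 (true ∷ false ∷ []) [ false ] []
Balanced-[4n+2] = balanced λ { false → refl ; true → refl }

S-[2n+1] : ∀ n → S (2 * n + 1) + S (2 * n) ≡ 3 * S n
S-[2n+1] zero    = refl
S-[2n+1] (suc m) = S-balanced (rep₂ (suc m)) (2 * suc m + 1) (2 * suc m) (suc m)
  (rep₂-[2n+1] (suc m)) (rep₂-[2n] m) (sym (++-identityʳ _)) Balanced-[2n+1]

S-[4n] : ∀ n → S (4 * n) + S n ≡ 2 * S (2 * n)
S-[4n] zero    = refl
S-[4n] (suc m) = S-balanced (rep₂ (suc m)) (4 * suc m) (suc m) (2 * suc m)
  (rep₂-[4n] m) (sym (++-identityʳ _)) (rep₂-[2n] m) Balanced-[4n]

S-[4n+2] : ∀ n → S (4 * n + 2) + S (2 * n) ≡ 4 * S n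
S-[4n+2] zero    = refl
S-[4n+2] (suc m) = S-balanced (rep₂ (suc m)) (4 * suc m + 2) (2 * suc m) (suc m)
  (rep₂-[4n+2] (suc m)) (rep₂-[2n] m) (sym (++-identityʳ _)) Balanced-[4n+2]

ℕ-sum⇒ℤ-difference : ∀ a b k c → a + b ≡ k * c → + a ≡ + k *ℤ + c - + b
ℕ-sum⇒ℤ-difference a b k c a+b≡kc = begin
  + a                  ≡⟨ cancel (+ a) (+ b) ⟩
  (+ a +ℤ + b) - + b   ≡⟨ cong (_- + b) (sym (pos-+ a b)) ⟩
  + (a + b) - + b      ≡⟨ cong (λ m → + m - + b) a+b≡kc ⟩
  + (k * c) - + b      ≡⟨ cong (_- + b) (pos-* k c) ⟩
  + k *ℤ + c - + b ∎
  where
  open ≡-Reasoning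
  cancel : ∀ x y → x ≡ (x +ℤ y) - y
  cancel = ℤ-Solver.solve-∀

InSpan-∈ : ∀ {P : Seq → Set} {f} → P f → InSpan P f
InSpan-∈ {f = f} Pf = ((1ℤ , f) ∷ []) , (Pf ∷ []) , λ n → unit (f n)
  where
  unit : ∀ x → x ≡ 1ℤ *ℤ x +ℤ 0ℤ
  unit = ℤ-Solver.solve-∀

1*n+0≡n : ∀ n → 1 * n + 0 ≡ n
1*n+0≡n = ℕ-Solver.solve-∀

module Regular
  (t : Seq) (α β γ δ ε ζ : ℤ)
  (t-[2n+1] : ∀ n → t (2 * n + 1) ≡ α *ℤ t n +ℤ β *ℤ t (2 * n))
  (t-[4n]   : ∀ n → t (4 * n)     ≡ γ *ℤ t n +ℤ δ *ℤ t (2 * n))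
  (t-[4n+2] : ∀ n → t (4 * n + 2) ≡ ε *ℤ t n +ℤ ζ *ℤ t (2 * n))
  where

  Comb : Seq → Set
  Comb g = Σ ℤ λ a → Σ ℤ λ b → ∀ n → g n ≡ a *ℤ t n +ℤ b *ℤ t (2 * n)

  Comb-cong : ∀ {g h} → (∀ n → g n ≡ h n) → Comb g → Comb h
  Comb-cong g≗h (a , b , g≡) = a , b , λ n → trans (sym (g≗h n)) (g≡ n)

  Comb-t : Comb t
  Comb-t = 1ℤ , 0ℤ , λ n → unit (t n) (t (2 * n))
    where
    unit : ∀ x y → x ≡ 1ℤ *ℤ x +ℤ 0ℤ *ℤ y
    unit = ℤ-Solver.solve-∀

  Comb-even : ∀ {g} → Comb g → Comb (λ n → g (2 * n))
  Comb-even {g} (a , b , g≡) = b *ℤ γ , a +ℤ b *ℤ δ , λ n → begin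
    g (2 * n)                                              ≡⟨ g≡ (2 * n) ⟩
    a *ℤ t (2 * n) +ℤ b *ℤ t (2 * (2 * n))                 ≡⟨ cong (λ m → a *ℤ t (2 * n) +ℤ b *ℤ t m) (arith n) ⟩
    a *ℤ t (2 * n) +ℤ b *ℤ t (4 * n)                       ≡⟨ cong (λ v → a *ℤ t (2 * n) +ℤ b *ℤ v) (t-[4n] n) ⟩
    a *ℤ t (2 * n) +ℤ b *ℤ (γ *ℤ t n +ℤ δ *ℤ t (2 * n))    ≡⟨ regroup a b γ δ (t n) (t (2 * n)) ⟩
    b *ℤ γ *ℤ t n +ℤ (a +ℤ b *ℤ δ) *ℤ t (2 * n) ∎
    where
    open ≡-Reasoning
    arith : ∀ n → 2 * (2 * n) ≡ 4 * n
    arith = ℕ-Solver.solve-∀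
    regroup : ∀ a b c d x y → a *ℤ y +ℤ b *ℤ (c *ℤ x +ℤ d *ℤ y) ≡ b *ℤ c *ℤ x +ℤ (a +ℤ b *ℤ d) *ℤ y
    regroup = ℤ-Solver.solve-∀

  Comb-odd : ∀ {g} → Comb g → Comb (λ n → g (2 * n + 1))
  Comb-odd {g} (a , b , g≡) = a *ℤ α +ℤ b *ℤ ε , a *ℤ β +ℤ b *ℤ ζ , λ n → begin
    g (2 * n + 1)                                                    ≡⟨ g≡ (2 * n + 1) ⟩
    a *ℤ t (2 * n + 1) +ℤ b *ℤ t (2 * (2 * n + 1))                   ≡⟨ cong (λ m → a *ℤ t (2 * n + 1) +ℤ b *ℤ t m) (arith n) ⟩
    a *ℤ t (2 * n + 1) +ℤ b *ℤ t (4 * n + 2)                         ≡⟨ cong₂ (λ u v → a *ℤ u +ℤ b *ℤ v) (t-[2n+1] n) (t-[4n+2] n) ⟩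
    a *ℤ (α *ℤ t n +ℤ β *ℤ t (2 * n)) +ℤ b *ℤ (ε *ℤ t n +ℤ ζ *ℤ t (2 * n)) ≡⟨ regroup a b α β ε ζ (t n) (t (2 * n)) ⟩
    (a *ℤ α +ℤ b *ℤ ε) *ℤ t n +ℤ (a *ℤ β +ℤ b *ℤ ζ) *ℤ t (2 * n) ∎
    where
    open ≡-Reasoning
    arith : ∀ n → 2 * (2 * n + 1) ≡ 4 * n + 2
    arith = ℕ-Solver.solve-∀
    regroup : ∀ a b c d e f x y →
      a *ℤ (c *ℤ x +ℤ d *ℤ y) +ℤ b *ℤ (e *ℤ x +ℤ f *ℤ y) ≡ (a *ℤ c +ℤ b *ℤ e) *ℤ x +ℤ (a *ℤ d +ℤ b *ℤ f) *ℤ y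
    regroup = ℤ-Solver.solve-∀

  Comb-digit : ∀ {g} r → r < 2 → Comb g → Comb (λ n → g (2 * n + r))
  Comb-digit {g} zero          _ c = Comb-cong (λ n → cong g (sym (+-identityʳ (2 * n)))) (Comb-even c)
  Comb-digit     (suc zero)    _ c = Comb-odd c
  Comb-digit     (suc (suc _)) (s≤s (s≤s ())) _

  Comb-kernel : ∀ i j → j < 2 ^ i → ∀ {g} → Comb g → Comb (λ n → g (2 ^ i * n + j))
  Comb-kernel zero    zero    _       {g} c = Comb-cong (λ n → cong g (sym (1*n+0≡n n))) c
  Comb-kernel zero    (suc _) (s≤s ())
  Comb-kernel (suc i) j       j<2^[1+i] {g} c =
    Comb-cong (λ n → cong g (sym (reindex n))) (Comb-kernel i (j / 2) j/2<2^i (Comb-digit (j % 2) (m%n<n j 2) c))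
    where
    j/2<2^i : j / 2 < 2 ^ i
    j/2<2^i = m<n*o⇒m/o<n (subst (j <_) (*-comm 2 (2 ^ i)) j<2^[1+i])
    arith : ∀ p n q r → 2 * p * n + (r + q * 2) ≡ 2 * (p * n + q) + r
    arith = ℕ-Solver.solve-∀
    reindex : ∀ n → 2 ^ suc i * n + j ≡ 2 * (2 ^ i * n + j / 2) + j % 2
    reindex n = trans (cong (_+_ (2 ^ suc i * n)) (m≡m%n+[m/n]*n j 2)) (arith (2 ^ i) n (j / 2) (j % 2))

  isRegular : IsRegular 2 t
  isRegular = generators , (InSpan-∈ t∈kernel ∷ InSpan-∈ t∘2*∈kernel ∷ []) , spans
    where
    generators : List Seq
    generators = t ∷ (t ∘ (2 *_)) ∷ []
    t∈kernel : InKernel 2 t t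
    t∈kernel = 0 , 0 , s≤s z≤n , λ n → cong t (sym (1*n+0≡n n))
    t∘2*∈kernel : InKernel 2 t (t ∘ (2 *_))
    t∘2*∈kernel = 1 , 0 , s≤s z≤n , λ n → cong t (sym (+-identityʳ (2 * n)))
    spans : ∀ f → InKernel 2 t f → InSpan (_∈ generators) f
    spans f (i , j , j<2^i , f≗) with Comb-kernel i j j<2^i Comb-t
    ... | a , b , t≡ = ((a , t) ∷ (b , t ∘ (2 *_)) ∷ []) , (here refl ∷ there (here refl) ∷ []) ,
      λ n → trans (f≗ n) (trans (t≡ n) (cong (a *ℤ t n +ℤ_) (sym (+ℤ-identityʳ (b *ℤ t (2 * n))))))

sub≡+-1* : ∀ x y → x - y ≡ x +ℤ -1ℤ *ℤ y
sub≡+-1* = ℤ-Solver.solve-∀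

sub≡-1*+ : ∀ x y → x - y ≡ -1ℤ *ℤ y +ℤ x
sub≡-1*+ = ℤ-Solver.solve-∀

S-[2n+1]ℤ : ∀ n → + S (2 * n + 1) ≡ + 3 *ℤ + S n - + S (2 * n)
S-[2n+1]ℤ n = ℕ-sum⇒ℤ-difference (S (2 * n + 1)) (S (2 * n)) 3 (S n) (S-[2n+1] n)

S-[4n]ℤ : ∀ n → + S (4 * n) ≡ + 2 *ℤ + S (2 * n) - + S n
S-[4n]ℤ n = ℕ-sum⇒ℤ-difference (S (4 * n)) (S n) 2 (S (2 * n)) (S-[4n] n)

S-[4n+2]ℤ : ∀ n → + S (4 * n + 2) ≡ + 4 *ℤ + S n - + S (2 * n)
S-[4n+2]ℤ n = ℕ-sum⇒ℤ-difference (S (4 * n + 2)) (S (2 * n)) 4 (S n) (S-[4n+2] n)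

theorem5p3 : ((n : ℕ) →
                ((+ S (2 * n + 1)) ≡ (+ 3) *ℤ (+ S n) - (+ S (2 * n))) ×
                ((+ S (4 * n)) ≡ (+ 2) *ℤ (+ S (2 * n)) - (+ S n)) ×
                ((+ S (4 * n + 2)) ≡ (+ 4) *ℤ (+ S n) - (+ S (2 * n))))
             × IsRegular 2 (λ n → + S n)
theorem5p3 = (λ n → S-[2n+1]ℤ n , S-[4n]ℤ n , S-[4n+2]ℤ n) ,
  Regular.isRegular (λ n → + S n) (+ 3) -1ℤ -1ℤ (+ 2) (+ 4) -1ℤ
    (λ n → trans (S-[2n+1]ℤ n) (sub≡+-1* (+ 3 *ℤ + S n) (+ S (2 * n))))
    (λ n → trans (S-[4n]ℤ n) (sub≡-1*+ (+ 2 *ℤ + S (2 * n)) (+ S n)))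
    (λ n → trans (S-[4n+2]ℤ n) (sub≡+-1* (+ 4 *ℤ + S n) (+ S (2 * n))))
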